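{- ${\bf ITL}^0$ is sound for the class of dynamical systems: whenever ${\bf ITL}^0\vdash\varphi$, then for every dynamical system $(X,\mathcal T,S)$ and every valuation $[\![\cdot]\!]$ on it, $[\![\varphi]\!]=X$.
   Context: The language $\mathcal L$ is given by $\bot \mid p \mid \varphi\wedge\psi\mid\varphi\vee\psi\mid\varphi\to\psi\mid\circ\varphi\mid\Diamond\varphi\mid\Box\varphi$, with $\neg\varphi:=\varphi\to\bot$. The logic ${\bf ITL}^0$ is the least set of $\mathcal L$-formulas containing all intuitionistic tautologies, $\neg\circ\bot$, $\circ(\varphi\wedge\psi)\leftrightarrow(\circ\varphi\wedge\circ\psi)$, $\circ(\varphi\vee\psi)\leftrightarrow(\circ\varphi\vee\circ\psi)$, $\circ(\varphi\to\psi)\to(\circ\varphi\to\circ\psi)$, $\Box(\varphi\to\psi)\to(\Box\varphi\to\Box\psi)$, $\Box(\varphi\to\psi)\to(\Diamond\varphi\to\Diamond\psi)$, $\Diamond(\varphi\vee\psi)\to(\Diamond\varphi\vee\Diamond\psi)$, $\Box\varphi\to\varphi\wedge\circ\Box\varphi$, $\varphi\vee\circ\Diamond\varphi\to\Diamond\varphi$, and closed under the rules: from $\varphi\to\circ\varphi$ infer $\varphi\to\Box\varphi$; from $\circ\varphi\to\varphi$ infer $\Diamond\varphi\to\varphi$; modus ponens; from $\varphi$ infer $\circ\varphi$. A dynamical system is $(X,\mathcal T,S)$ with $(X,\mathcal T)$ a topological space and $S$ continuous. A valuation maps formulas to open sets with $[\![\bot]\!]=\varnothing$, $[\![\varphi\wedge\psi]\!]=[\![\varphi]\!]\cap[\![\psi]\!]$,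 $[\![\varphi\vee\psi]\!]=[\![\varphi]\!]\cup[\![\psi]\!]$, $[\![\varphi\to\psi]\!]=((X\setminus[\![\varphi]\!])\cup[\![\psi]\!])^\circ$, $[\![\circ\varphi]\!]=S^{ -1}[\![\varphi]\!]$, $[\![\Diamond\varphi]\!]=\bigcup_{n\ge0}S^{ -n}[\![\varphi]\!]$, $[\![\Box\varphi]\!]=\bigcup\{U\in\mathcal T:S[U]\subseteq U\subseteq[\![\varphi]\!]\}$. -}

module Defs where

open import Level using (Level; 0ℓ) renaming (suc to lsuc)
open import Data.Nat using (ℕ; zero; suc)
open import Data.Product using (Σ; _×_; _,_)
open import Data.Sum using (_⊎_)
open import Data.Empty using (⊥)
open import Data.Unit using (⊤)
open import Relation.Nullary using (¬_)

infixr 4 _⇒_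
infixr 5 _∨_
infixr 6 _∧_

data Formula : Set where
  ⊥'   : Formula
  var  : ℕ → Formula
  _∧_  : Formula → Formula → Formula
  _∨_  : Formula → Formula → Formula
  _⇒_  : Formula → Formula → Formula
  ○    : Formula → Formula
  ◇    : Formula → Formula
  □    : Formula → Formula

¬' : Formula → Formula
¬' φ = φ ⇒ ⊥'

_⇔_ : Formula → Formula → Formula
φ ⇔ ψ = (φ ⇒ ψ) ∧ (ψ ⇒ φ)

-- The logic ITL⁰.  "All intuitionistic tautologies" is realised by a
-- complete Hilbert axiomatisation of intuitionistic propositional logic
-- (all instances in 𝓛 of the schemata below, closed under modus ponens).

data ITL⁰ : Formula → Set where
  ax-K    : ∀ φ ψ → ITL⁰ (φ ⇒ ψ ⇒ φ)
  ax-S    : ∀ φ ψ χ → ITL⁰ ((φ ⇒ ψ ⇒ χ) ⇒ (φ ⇒ ψ) ⇒ φ ⇒ χ)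
  ax-∧I   : ∀ φ ψ → ITL⁰ (φ ⇒ ψ ⇒ φ ∧ ψ)
  ax-∧E₁  : ∀ φ ψ → ITL⁰ (φ ∧ ψ ⇒ φ)
  ax-∧E₂  : ∀ φ ψ → ITL⁰ (φ ∧ ψ ⇒ ψ)
  ax-∨I₁  : ∀ φ ψ → ITL⁰ (φ ⇒ φ ∨ ψ)
  ax-∨I₂  : ∀ φ ψ → ITL⁰ (ψ ⇒ φ ∨ ψ)
  ax-∨E   : ∀ φ ψ χ → ITL⁰ ((φ ⇒ χ) ⇒ (ψ ⇒ χ) ⇒ φ ∨ ψ ⇒ χ)
  ax-⊥E   : ∀ φ → ITL⁰ (⊥' ⇒ φ)
  ax-○⊥   : ITL⁰ (¬' (○ ⊥'))
  ax-○∧   : ∀ φ ψ → ITL⁰ (○ (φ ∧ ψ) ⇔ (○ φ ∧ ○ ψ))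
  ax-○∨   : ∀ φ ψ → ITL⁰ (○ (φ ∨ ψ) ⇔ (○ φ ∨ ○ ψ))
  ax-○⇒   : ∀ φ ψ → ITL⁰ (○ (φ ⇒ ψ) ⇒ (○ φ ⇒ ○ ψ))
  ax-□K   : ∀ φ ψ → ITL⁰ (□ (φ ⇒ ψ) ⇒ (□ φ ⇒ □ ψ))
  ax-□◇   : ∀ φ ψ → ITL⁰ (□ (φ ⇒ ψ) ⇒ (◇ φ ⇒ ◇ ψ))
  ax-◇∨   : ∀ φ ψ → ITL⁰ (◇ (φ ∨ ψ) ⇒ (◇ φ ∨ ◇ ψ))
  ax-□fix : ∀ φ → ITL⁰ (□ φ ⇒ φ ∧ ○ (□ φ))
  ax-◇fix : ∀ φ → ITL⁰ (φ ∨ ○ (◇ φ) ⇒ ◇ φ)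
  ind-□   : ∀ φ → ITL⁰ (φ ⇒ ○ φ) → ITL⁰ (φ ⇒ □ φ)
  ind-◇   : ∀ φ → ITL⁰ (○ φ ⇒ φ) → ITL⁰ (◇ φ ⇒ φ)
  mp      : ∀ φ ψ → ITL⁰ (φ ⇒ ψ) → ITL⁰ φ → ITL⁰ ψ
  nec     : ∀ φ → ITL⁰ φ → ITL⁰ (○ φ)

Subset : Set → Set₁
Subset X = X → Set

record _↔_ {a b : Level} (A : Set a) (B : Set b) : Set (a Level.⊔ b) where
  field
    to   : A → B
    from : B → A

_⊆_ : {X : Set} → Subset X → Subset X → Set
U ⊆ V = ∀ x → U x → V x

record Topology (X : Set) : Set₂ where
  field
    Open      : Subset X → Set₁
    open-ext  : ∀ U V → U ⊆ V → V ⊆ U → Open U → Open V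
    open-univ : Open (λ _ → ⊤)
    open-∩    : ∀ U V → Open U → Open V → Open (λ x → U x × V x)
    open-⋃    : (I : Set) (U : I → Subset X) → (∀ i → Open (U i)) →
                Open (λ x → Σ I (λ i → U i x))

record DynamicalSystem : Set₃ where
  field
    X    : Set
    𝒯    : Topology X
    S    : X → X
    cont : ∀ U → Topology.Open 𝒯 U → Topology.Open 𝒯 (λ x → U (S x))

iterate : {X : Set} → (X → X) → ℕ → X → X
iterate f zero    x = x
iterate f (suc n) x = iterate f n (f x)

-- Valuations (a valuation maps formulas to open sets, satisfying the
-- clauses; equality of subsets is pointwise logical equivalence)

record Valuation (D : DynamicalSystem) : Set₂ where
  open DynamicalSystem D
  open Topology 𝒯
  field
    ⟦_⟧   : Formula → Subset X
    open⟦⟧ : ∀ φ → Open ⟦ φ ⟧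
    ⟦⊥⟧   : ∀ x → ⟦ ⊥' ⟧ x ↔ ⊥
    ⟦∧⟧   : ∀ φ ψ x → ⟦ φ ∧ ψ ⟧ x ↔ (⟦ φ ⟧ x × ⟦ ψ ⟧ x)
    ⟦∨⟧   : ∀ φ ψ x → ⟦ φ ∨ ψ ⟧ x ↔ (⟦ φ ⟧ x ⊎ ⟦ ψ ⟧ x)
    -- interior of (X ∖ ⟦φ⟧) ∪ ⟦ψ⟧ = union of the open sets contained in it
    ⟦⇒⟧   : ∀ φ ψ x → ⟦ φ ⇒ ψ ⟧ x ↔
              Σ (Subset X) (λ U → Open U ×
                 (U ⊆ (λ y → (¬ ⟦ φ ⟧ y) ⊎ ⟦ ψ ⟧ y)) × U x)
    ⟦○⟧   : ∀ φ x → ⟦ ○ φ ⟧ x ↔ ⟦ φ ⟧ (S x)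
    ⟦◇⟧   : ∀ φ x → ⟦ ◇ φ ⟧ x ↔ Σ ℕ (λ n → ⟦ φ ⟧ (iterate S n x))
    ⟦□⟧   : ∀ φ x → ⟦ □ φ ⟧ x ↔
              Σ (Subset X) (λ U → Open U × (∀ y → U y → U (S y)) ×
                 (U ⊆ ⟦ φ ⟧) × U x)

module Submission where

-- The only non-trivial connective is implication:
-- ⟦φ ⇒ ψ⟧ is an interior, so (using excluded middle to decide ⟦φ⟧ y)
-- a point lies in it exactly when φ entails ψ on some open neighbourhood
-- of it ("local entailment").  Since X itself is open, global entailment
-- ⟦φ⟧ ⊆ ⟦ψ⟧ makes φ ⇒ ψ valid, which is how every axiom is verified.
-- For the temporal operators we use that ⟦□φ⟧ is the union of the open
-- S-invariant subsets of ⟦φ⟧, and that invariant sets are closed under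
-- iterates of S, while ⟦◇φ⟧ collects the points with an iterate in ⟦φ⟧.

open import Defs
open import Level using (0ℓ) renaming (suc to lsuc)
open import Axiom.ExcludedMiddle using (ExcludedMiddle)
open import Data.Nat using (zero; suc)
open import Data.Product using (_×_; _,_; proj₁; proj₂)
open import Data.Sum using (_⊎_; inj₁; inj₂)
open import Data.Empty using (⊥-elim)
open import Data.Unit using (tt)
open import Relation.Nullary using (¬_; yes; no)

module Semantics (lem : ExcludedMiddle 0ℓ) (D : DynamicalSystem) (V : Valuation D) where
  open DynamicalSystem D
  open Topology 𝒯
  open Valuation V
  open _↔_

  Valid : Formula → Set
  Valid φ = ∀ x → ⟦ φ ⟧ x

  Invariant : Subset X → Set
  Invariant U = ∀ y → U y → U (S y)

  record LocallyEntails (φ ψ : Formula) (x : X) : Set₁ where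
    constructor local
    field
      nbhd       : Subset X
      nbhd-open  : Open nbhd
      nbhd-point : nbhd x
      entails    : ∀ y → nbhd y → ⟦ φ ⟧ y → ⟦ ψ ⟧ y

  -- Local entailment puts x in the interior ⟦φ ⇒ ψ⟧; excluded middle
  -- turns "φ entails ψ" into "not φ or ψ" pointwise.
  ⇒-intro : ∀ {φ ψ x} → LocallyEntails φ ψ x → ⟦ φ ⇒ ψ ⟧ x
  ⇒-intro {φ} {ψ} {x} (local U oU ux entails) =
    from (⟦⇒⟧ φ ψ x) (U , oU , notφ-or-ψ , ux)
    where
    notφ-or-ψ : U ⊆ (λ y → (¬ ⟦ φ ⟧ y) ⊎ ⟦ ψ ⟧ y)
    notφ-or-ψ y uy with lem {⟦ φ ⟧ y}
    ... | yes p = inj₂ (entails y uy p)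
    ... | no ¬p = inj₁ ¬p

  ⇒-local : ∀ {φ ψ x} → ⟦ φ ⇒ ψ ⟧ x → LocallyEntails φ ψ x
  ⇒-local {φ} {ψ} {x} h with to (⟦⇒⟧ φ ψ x) h
  ... | U , oU , notφ-or-ψ , ux = local U oU ux entails
    where
    entails : ∀ y → U y → ⟦ φ ⟧ y → ⟦ ψ ⟧ y
    entails y uy p with notφ-or-ψ y uy
    ... | inj₁ ¬p = ⊥-elim (¬p p)
    ... | inj₂ q  = q

  ⇒-elim : ∀ {φ ψ x} → ⟦ φ ⇒ ψ ⟧ x → ⟦ φ ⟧ x → ⟦ ψ ⟧ x
  ⇒-elim h p with ⇒-local h
  ... | local U _ ux entails = entails _ ux p

  ⇒-valid : ∀ {φ ψ} → (∀ y → ⟦ φ ⟧ y → ⟦ ψ ⟧ y) → Valid (φ ⇒ ψ)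
  ⇒-valid entails x = ⇒-intro (local (λ _ → _) open-univ tt (λ y _ → entails y))

  ⇔-valid : ∀ {φ ψ} → (∀ y → ⟦ φ ⟧ y → ⟦ ψ ⟧ y) → (∀ y → ⟦ ψ ⟧ y → ⟦ φ ⟧ y) →
            Valid (φ ⇔ ψ)
  ⇔-valid {φ} {ψ} φ⊢ψ ψ⊢φ x = from (⟦∧⟧ (φ ⇒ ψ) (ψ ⇒ φ) x) (⇒-valid φ⊢ψ x , ⇒-valid ψ⊢φ x)

  invariant-iterate : ∀ {U} → Invariant U → ∀ n y → U y → U (iterate S n y)
  invariant-iterate inv zero    y u = u
  invariant-iterate inv (suc n) y u = invariant-iterate inv n (S y) (inv y u)

  □-intro : ∀ {φ U} → Open U → Invariant U → U ⊆ ⟦ φ ⟧ → U ⊆ ⟦ □ φ ⟧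
  □-intro {φ} {U} oU inv U⊆φ y uy = from (⟦□⟧ φ y) (U , oU , inv , U⊆φ , uy)

  ∩-open : ∀ {U W} → Open U → Open W → Open (λ y → U y × W y)
  ∩-open = open-∩ _ _

  ∩-invariant : ∀ {U W} → Invariant U → Invariant W → Invariant (λ y → U y × W y)
  ∩-invariant invU invW y (u , w) = invU y u , invW y w

  valid-K : ∀ φ ψ → Valid (φ ⇒ ψ ⇒ φ)
  valid-K φ ψ = ⇒-valid λ y p → ⇒-intro (local ⟦ φ ⟧ (open⟦⟧ φ) p (λ z pz _ → pz))

  -- The neighbourhood for the innermost implication is the intersection
  -- of those witnessing the two hypotheses.
  valid-S : ∀ φ ψ χ → Valid ((φ ⇒ ψ ⇒ χ) ⇒ (φ ⇒ ψ) ⇒ φ ⇒ χ)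
  valid-S φ ψ χ = ⇒-valid λ y hψχ →
    let local U oU uy φ⊢ψ⇒χ = ⇒-local hψχ in
    ⇒-intro (local U oU uy λ z uz hψ →
      let local W oW wz φ⊢ψ = ⇒-local hψ in
      ⇒-intro (local (λ w → U w × W w) (∩-open oU oW) (uz , wz)
        λ w (uw , ww) p → ⇒-elim (φ⊢ψ⇒χ w uw p) (φ⊢ψ w ww p)))

  valid-∧I : ∀ φ ψ → Valid (φ ⇒ ψ ⇒ φ ∧ ψ)
  valid-∧I φ ψ = ⇒-valid λ y p →
    ⇒-intro (local ⟦ φ ⟧ (open⟦⟧ φ) p λ z pz qz → from (⟦∧⟧ φ ψ z) (pz , qz))

  valid-∧E₁ : ∀ φ ψ → Valid (φ ∧ ψ ⇒ φ)
  valid-∧E₁ φ ψ = ⇒-valid λ y h → proj₁ (to (⟦∧⟧ φ ψ y) h)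

  valid-∧E₂ : ∀ φ ψ → Valid (φ ∧ ψ ⇒ ψ)
  valid-∧E₂ φ ψ = ⇒-valid λ y h → proj₂ (to (⟦∧⟧ φ ψ y) h)

  valid-∨I₁ : ∀ φ ψ → Valid (φ ⇒ φ ∨ ψ)
  valid-∨I₁ φ ψ = ⇒-valid λ y p → from (⟦∨⟧ φ ψ y) (inj₁ p)

  valid-∨I₂ : ∀ φ ψ → Valid (ψ ⇒ φ ∨ ψ)
  valid-∨I₂ φ ψ = ⇒-valid λ y q → from (⟦∨⟧ φ ψ y) (inj₂ q)

  -- Again the innermost neighbourhood is an intersection; on it each
  -- disjunct entails χ.
  valid-∨E : ∀ φ ψ χ → Valid ((φ ⇒ χ) ⇒ (ψ ⇒ χ) ⇒ φ ∨ ψ ⇒ χ)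
  valid-∨E φ ψ χ = ⇒-valid λ y hφ →
    let local U oU uy φ⊢χ = ⇒-local hφ in
    ⇒-intro (local U oU uy λ z uz hψ →
      let local W oW wz ψ⊢χ = ⇒-local hψ in
      ⇒-intro (local (λ w → U w × W w) (∩-open oU oW) (uz , wz)
        λ w (uw , ww) d → by-cases (φ⊢χ w uw) (ψ⊢χ w ww) (to (⟦∨⟧ φ ψ w) d)))
    where
    by-cases : ∀ {w} → (⟦ φ ⟧ w → ⟦ χ ⟧ w) → (⟦ ψ ⟧ w → ⟦ χ ⟧ w) →
               ⟦ φ ⟧ w ⊎ ⟦ ψ ⟧ w → ⟦ χ ⟧ w
    by-cases f g (inj₁ p) = f p
    by-cases f g (inj₂ q) = g q

  valid-⊥E : ∀ φ → Valid (⊥' ⇒ φ)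
  valid-⊥E φ = ⇒-valid λ y h → ⊥-elim (to (⟦⊥⟧ y) h)

  -- ○ is the preimage under S, which commutes with ⊥, ∧, ∨ pointwise.
  valid-○⊥ : Valid (¬' (○ ⊥'))
  valid-○⊥ = ⇒-valid λ y h → ⊥-elim (to (⟦⊥⟧ (S y)) (to (⟦○⟧ ⊥' y) h))

  valid-○∧ : ∀ φ ψ → Valid (○ (φ ∧ ψ) ⇔ (○ φ ∧ ○ ψ))
  valid-○∧ φ ψ = ⇔-valid split join
    where
    split : ∀ y → ⟦ ○ (φ ∧ ψ) ⟧ y → ⟦ ○ φ ∧ ○ ψ ⟧ y
    split y h with to (⟦∧⟧ φ ψ (S y)) (to (⟦○⟧ (φ ∧ ψ) y) h)
    ... | p , q = from (⟦∧⟧ (○ φ) (○ ψ) y) (from (⟦○⟧ φ y) p , from (⟦○⟧ ψ y) q)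
    join : ∀ y → ⟦ ○ φ ∧ ○ ψ ⟧ y → ⟦ ○ (φ ∧ ψ) ⟧ y
    join y h with to (⟦∧⟧ (○ φ) (○ ψ) y) h
    ... | p , q = from (⟦○⟧ (φ ∧ ψ) y) (from (⟦∧⟧ φ ψ (S y)) (to (⟦○⟧ φ y) p , to (⟦○⟧ ψ y) q))

  valid-○∨ : ∀ φ ψ → Valid (○ (φ ∨ ψ) ⇔ (○ φ ∨ ○ ψ))
  valid-○∨ φ ψ = ⇔-valid (λ y h → split y (to (⟦∨⟧ φ ψ (S y)) (to (⟦○⟧ (φ ∨ ψ) y) h)))
                         (λ y h → join y (to (⟦∨⟧ (○ φ) (○ ψ) y) h))
    where
    split : ∀ y → ⟦ φ ⟧ (S y) ⊎ ⟦ ψ ⟧ (S y) → ⟦ ○ φ ∨ ○ ψ ⟧ y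
    split y (inj₁ p) = from (⟦∨⟧ (○ φ) (○ ψ) y) (inj₁ (from (⟦○⟧ φ y) p))
    split y (inj₂ q) = from (⟦∨⟧ (○ φ) (○ ψ) y) (inj₂ (from (⟦○⟧ ψ y) q))
    join : ∀ y → ⟦ ○ φ ⟧ y ⊎ ⟦ ○ ψ ⟧ y → ⟦ ○ (φ ∨ ψ) ⟧ y
    join y (inj₁ p) = from (⟦○⟧ (φ ∨ ψ) y) (from (⟦∨⟧ φ ψ (S y)) (inj₁ (to (⟦○⟧ φ y) p)))
    join y (inj₂ q) = from (⟦○⟧ (φ ∨ ψ) y) (from (⟦∨⟧ φ ψ (S y)) (inj₂ (to (⟦○⟧ ψ y) q)))

  -- The neighbourhood of S y witnessing φ ⇒ ψ pulls back, by continuity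
  -- of S, to a neighbourhood of y on which ○φ entails ○ψ.
  valid-○⇒ : ∀ φ ψ → Valid (○ (φ ⇒ ψ) ⇒ (○ φ ⇒ ○ ψ))
  valid-○⇒ φ ψ = ⇒-valid λ y h →
    let local U oU uSy φ⊢ψ = ⇒-local (to (⟦○⟧ (φ ⇒ ψ) y) h) in
    ⇒-intro (local (λ z → U (S z)) (cont U oU) uSy
      λ z uSz p → from (⟦○⟧ ψ z) (φ⊢ψ (S z) uSz (to (⟦○⟧ φ z) p)))

  -- If U is an invariant neighbourhood inside ⟦φ ⇒ ψ⟧ and W one inside
  -- ⟦φ⟧, then U ∩ W is an open invariant set inside ⟦ψ⟧.
  valid-□K : ∀ φ ψ → Valid (□ (φ ⇒ ψ) ⇒ (□ φ ⇒ □ ψ))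
  valid-□K φ ψ = ⇒-valid λ y h →
    let (U , oU , invU , U⊆φ⇒ψ , uy) = to (⟦□⟧ (φ ⇒ ψ) y) h in
    ⇒-intro (local U oU uy λ z uz hφ →
      let (W , oW , invW , W⊆φ , wz) = to (⟦□⟧ φ z) hφ in
      □-intro (∩-open oU oW) (∩-invariant invU invW)
        (λ w (uw , ww) → ⇒-elim (U⊆φ⇒ψ w uw) (W⊆φ w ww)) z (uz , wz))

  -- A witness Sⁿ z ∈ ⟦φ⟧ stays in the invariant neighbourhood U ⊆ ⟦φ ⇒ ψ⟧,
  -- so it is also a witness for ◇ψ.
  valid-□◇ : ∀ φ ψ → Valid (□ (φ ⇒ ψ) ⇒ (◇ φ ⇒ ◇ ψ))
  valid-□◇ φ ψ = ⇒-valid λ y h →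
    let (U , oU , invU , U⊆φ⇒ψ , uy) = to (⟦□⟧ (φ ⇒ ψ) y) h in
    ⇒-intro (local U oU uy λ z uz hφ →
      let (n , p) = to (⟦◇⟧ φ z) hφ in
      from (⟦◇⟧ ψ z) (n , ⇒-elim (U⊆φ⇒ψ _ (invariant-iterate invU n z uz)) p))

  valid-◇∨ : ∀ φ ψ → Valid (◇ (φ ∨ ψ) ⇒ (◇ φ ∨ ◇ ψ))
  valid-◇∨ φ ψ = ⇒-valid λ y h →
    let (n , d) = to (⟦◇⟧ (φ ∨ ψ) y) h in witness y n (to (⟦∨⟧ φ ψ _) d)
    where
    witness : ∀ y n → ⟦ φ ⟧ (iterate S n y) ⊎ ⟦ ψ ⟧ (iterate S n y) → ⟦ ◇ φ ∨ ◇ ψ ⟧ y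
    witness y n (inj₁ p) = from (⟦∨⟧ (◇ φ) (◇ ψ) y) (inj₁ (from (⟦◇⟧ φ y) (n , p)))
    witness y n (inj₂ q) = from (⟦∨⟧ (◇ φ) (◇ ψ) y) (inj₂ (from (⟦◇⟧ ψ y) (n , q)))

  -- An invariant set witnessing □φ at y also witnesses it at S y.
  valid-□fix : ∀ φ → Valid (□ φ ⇒ φ ∧ ○ (□ φ))
  valid-□fix φ = ⇒-valid λ y h →
    let (U , oU , invU , U⊆φ , uy) = to (⟦□⟧ φ y) h in
    from (⟦∧⟧ φ (○ (□ φ)) y)
      (U⊆φ y uy , from (⟦○⟧ (□ φ) y) (□-intro oU invU U⊆φ (S y) (invU y uy)))

  -- φ at y is the witness n = 0; a witness n for ◇φ at S y is n + 1 at y.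
  valid-◇fix : ∀ φ → Valid (φ ∨ ○ (◇ φ) ⇒ ◇ φ)
  valid-◇fix φ = ⇒-valid λ y h → now-or-later y (to (⟦∨⟧ φ (○ (◇ φ)) y) h)
    where
    now-or-later : ∀ y → ⟦ φ ⟧ y ⊎ ⟦ ○ (◇ φ) ⟧ y → ⟦ ◇ φ ⟧ y
    now-or-later y (inj₁ p) = from (⟦◇⟧ φ y) (0 , p)
    now-or-later y (inj₂ q) =
      let (n , p) = to (⟦◇⟧ φ (S y)) (to (⟦○⟧ (◇ φ) y) q) in
      from (⟦◇⟧ φ y) (suc n , p)

  -- If φ ⇒ ○φ is valid, ⟦φ⟧ is itself an open invariant set.
  ind-□-valid : ∀ φ → Valid (φ ⇒ ○ φ) → Valid (φ ⇒ □ φ)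
  ind-□-valid φ step = ⇒-valid (□-intro (open⟦⟧ φ) invariant (λ _ p → p))
    where
    invariant : Invariant ⟦ φ ⟧
    invariant z p = to (⟦○⟧ φ z) (⇒-elim (step z) p)

  -- If ○φ ⇒ φ is valid, φ propagates backwards along an orbit.
  ind-◇-valid : ∀ φ → Valid (○ φ ⇒ φ) → Valid (◇ φ ⇒ φ)
  ind-◇-valid φ step = ⇒-valid λ y h → let (n , p) = to (⟦◇⟧ φ y) h in back n y p
    where
    back : ∀ n y → ⟦ φ ⟧ (iterate S n y) → ⟦ φ ⟧ y
    back zero    y p = p
    back (suc n) y p = ⇒-elim (step y) (from (⟦○⟧ φ y) (back n (S y) p))

  mp-valid : ∀ φ ψ → Valid (φ ⇒ ψ) → Valid φ → Valid ψ
  mp-valid φ ψ hφψ hφ x = ⇒-elim (hφψ x) (hφ x)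

  nec-valid : ∀ φ → Valid φ → Valid (○ φ)
  nec-valid φ hφ x = from (⟦○⟧ φ x) (hφ (S x))

  sound : ∀ {φ} → ITL⁰ φ → Valid φ
  sound (ax-K φ ψ)     = valid-K φ ψ
  sound (ax-S φ ψ χ)   = valid-S φ ψ χ
  sound (ax-∧I φ ψ)    = valid-∧I φ ψ
  sound (ax-∧E₁ φ ψ)   = valid-∧E₁ φ ψ
  sound (ax-∧E₂ φ ψ)   = valid-∧E₂ φ ψ
  sound (ax-∨I₁ φ ψ)   = valid-∨I₁ φ ψ
  sound (ax-∨I₂ φ ψ)   = valid-∨I₂ φ ψ
  sound (ax-∨E φ ψ χ)  = valid-∨E φ ψ χ
  sound (ax-⊥E φ)      = valid-⊥E φ
  sound ax-○⊥          = valid-○⊥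
  sound (ax-○∧ φ ψ)    = valid-○∧ φ ψ
  sound (ax-○∨ φ ψ)    = valid-○∨ φ ψ
  sound (ax-○⇒ φ ψ)    = valid-○⇒ φ ψ
  sound (ax-□K φ ψ)    = valid-□K φ ψ
  sound (ax-□◇ φ ψ)    = valid-□◇ φ ψ
  sound (ax-◇∨ φ ψ)    = valid-◇∨ φ ψ
  sound (ax-□fix φ)    = valid-□fix φ
  sound (ax-◇fix φ)    = valid-◇fix φ
  sound (ind-□ φ d)    = ind-□-valid φ (sound d)
  sound (ind-◇ φ d)    = ind-◇-valid φ (sound d)
  sound (mp φ ψ d e)   = mp-valid φ ψ (sound d) (sound e)
  sound (nec φ d)      = nec-valid φ (sound d)

-- Theorem 5.2: ITL⁰ is sound for the class of dynamical systems.
theorem5p2 : ExcludedMiddle 0ℓ → ExcludedMiddle (lsuc 0ℓ) →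
    ∀ φ → ITL⁰ φ → (D : DynamicalSystem) (V : Valuation D) →
    ∀ (x : DynamicalSystem.X D) → Valuation.⟦_⟧ V φ x
theorem5p2 lem _ φ derivation D V = Semantics.sound lem D V derivation
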